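{- Let $H$ be an unweighted directed $t$-vertex graph and let $G_1,\dots,G_t$ be vertex-weighted directed graphs such that $\mathrm{Subst}_H(G_1,\dots,G_t)$ does not contain a negative cycle. Let $u,v\in V(\mathrm{Subst}_H(G_1,\dots,G_t))$ be such that there exists a shortest $u$-$v$ path and $\{u,v\}\not\subseteq V(G_i)$ for all $i\in[t]$. Then there exists a shortest $u$-$v$ path $P$ in $\mathrm{Subst}_H(G_1,\dots,G_t)$ in which the occurrences of vertices of each $G_i$ occur consecutively.
   Context: For a directed graph $H$ with $V(H)=\{v_1,\dots,v_t\}$, $\mathrm{Subst}_H(G_1,\dots,G_t)$ replaces each $v_i$ by a disjoint copy of $G_i$ (keeping its arcs and vertex weights) and adds all arcs from $V(G_i)$ to $V(G_j)$ whenever $(v_i,v_j)\in E(H)$. The weight of a path or cycle is the sum of its vertex weights; a negative cycle is a directed cycle of negative weight; a shortest $u$-$v$ path is a directed $u$-$v$ path of minimum weight. -}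

module Defs where

open import Data.Nat using (ℕ)
open import Data.Fin using (Fin; toℕ)
open import Data.Integer using (ℤ; _≤_; _<_; 0ℤ; _+_)
open import Data.List using (List; []; _∷_; map; foldr; length; lookup)
open import Data.List.Relation.Unary.Unique.Propositional using (Unique)
open import Data.Product using (Σ; ∃; ∃₂; _×_; _,_; proj₁)
open import Data.Sum using (_⊎_)
open import Relation.Binary.PropositionalEquality using (_≡_)
open import Relation.Nullary using (¬_)
import Data.Nat as ℕ

record WDigraph (n : ℕ) : Set₁ where
  field
    arc    : Fin n → Fin n → Set
    weight : Fin n → ℤ
open WDigraph public

Digraph : ℕ → Set₁
Digraph t = Fin t → Fin t → Set

module _ {V : Set} (arcR : V → V → Set) (w : V → ℤ) where

  data Walk : V → V → List V → Set where
    single : ∀ {u} → Walk u u (u ∷ [])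
    step   : ∀ {u x v P} → arcR u x → Walk x v P → Walk u v (u ∷ P)

  IsPath : V → V → List V → Set
  IsPath u v P = Walk u v P × Unique P

  wt : List V → ℤ
  wt P = foldr _+_ 0ℤ (map w P)

  IsCycle : List V → Set
  IsCycle C = ∃₂ λ a b → IsPath a b C × arcR b a

  NoNegativeCycle : Set
  NoNegativeCycle = ∀ C → IsCycle C → ¬ (wt C < 0ℤ)

  IsShortestPath : V → V → List V → Set
  IsShortestPath u v P = IsPath u v P × (∀ Q → IsPath u v Q → wt P ≤ wt Q)

module _ {t : ℕ} {sz : Fin t → ℕ} where

  SVertex : Set
  SVertex = Σ (Fin t) (λ i → Fin (sz i))

  data SubstArc (H : Digraph t) (G : (i : Fin t) → WDigraph (sz i))
       : SVertex → SVertex → Set where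
    inner : ∀ {i a b} → arc (G i) a b → SubstArc H G (i , a) (i , b)
    outer : ∀ {i j a b} → H i j → SubstArc H G (i , a) (j , b)

  SubstWeight : (G : (i : Fin t) → WDigraph (sz i)) → SVertex → ℤ
  SubstWeight G (i , a) = weight (G i) a

BlocksConsecutive : ∀ {t} {sz : Fin t → ℕ} → List (Σ (Fin t) (λ i → Fin (sz i))) → Set
BlocksConsecutive P =
  ∀ (a b c : Fin (length P)) → toℕ a ℕ.≤ toℕ b → toℕ b ℕ.≤ toℕ c →
  proj₁ (lookup P a) ≡ proj₁ (lookup P c) →
  proj₁ (lookup P b) ≡ proj₁ (lookup P a)

{-# OPTIONS --safe #-}
module Submission where

-- Among the shortest u–v paths take one with fewest vertices. If its blocks were not
-- consecutive, it would contain a segment m … m', entered from x and left to y, such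
-- that both x → m and m' → y change block and either x and m' lie in the same block
-- or m and y do. Arcs between different blocks of a substitution depend only on the
-- blocks, so m' → m and x → y are arcs as well: the segment is a cycle, hence of
-- nonnegative weight, and cutting it out gives a shortest path with fewer vertices.
-- The only non-consecutive shape without such a segment is one in which the last
-- block of the path is the block of its first vertex, which {u, v} ⊈ V(G_i) excludes.

open import Defs
open import Data.Nat using (ℕ; s≤s; z≤n) renaming (_≤_ to _≤ℕ_; _<_ to _<ℕ_)
open import Data.Nat.Induction using (<-wellFounded)
import Data.Nat.Properties as ℕ
open import Data.Fin using (Fin; toℕ; _≟_)
import Data.Fin as Fin
open import Data.List using (List; []; _∷_; _++_; length; lookup)
open import Data.List.Properties using (length-++)
open import Data.List.Membership.Propositional.Properties using (∈-lookup)
open import Data.List.Relation.Unary.All as All using (All; []; _∷_)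
import Data.List.Relation.Unary.All.Properties as All
open import Data.List.Relation.Unary.Any as Any using (Any; any?)
open import Data.List.Relation.Unary.AllPairs using ([]; _∷_)
open import Data.List.Relation.Unary.Grouped using (Grouped; []; _∷≉_; _∷≈_)
open import Data.List.Relation.Unary.Unique.Propositional using (Unique)
open import Data.Integer using (ℤ; 0ℤ; _+_; _≤_)
import Data.Integer.Properties as ℤ
open import Data.Product using (Σ; ∃; _×_; _,_; proj₁)
import Data.Product as Product
open import Data.Sum using (_⊎_; inj₁; inj₂)
import Data.Sum as Sum
open import Data.Empty using (⊥-elim)
open import Function using (_∘_; _on_; id)
open import Induction.WellFounded using (Acc; acc)
open import Relation.Binary using (Rel; IsEquivalence; DecidableEquality)
import Relation.Binary.Construct.On as On
open import Relation.Binary.PropositionalEquality as ≡ using (_≡_; _≢_; refl; sym; trans; cong)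
open import Relation.Nullary using (¬_; yes; no)

data Last {A : Set} : List A → A → Set where
  last-[] : ∀ {x} → Last (x ∷ []) x
  last-∷  : ∀ {y z L} → Last L z → Last (y ∷ L) z

module _ {A : Set} where

  Last-++⁻ʳ : ∀ (L : List A) {y B z} → Last (L ++ y ∷ B) z → Last (y ∷ B) z
  Last-++⁻ʳ []          l          = l
  Last-++⁻ʳ (_ ∷ [])    (last-∷ l) = l
  Last-++⁻ʳ (_ ∷ x ∷ L) (last-∷ l) = Last-++⁻ʳ (x ∷ L) l

  All-last : ∀ {P : A → Set} {L z} → All P L → Last L z → P z
  All-last (p ∷ _)  last-[]    = p
  All-last (_ ∷ ps) (last-∷ l) = All-last ps l

  Unique-++⁻ˡ : ∀ (L : List A) {M} → Unique (L ++ M) → Unique L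
  Unique-++⁻ˡ []      _        = []
  Unique-++⁻ˡ (_ ∷ L) (x∉ ∷ u) = All.++⁻ˡ L x∉ ∷ Unique-++⁻ˡ L u

  Unique-++⁻ʳ : ∀ (L : List A) {M} → Unique (L ++ M) → Unique M
  Unique-++⁻ʳ []      u       = u
  Unique-++⁻ʳ (_ ∷ L) (_ ∷ u) = Unique-++⁻ʳ L u

  Unique-dropMiddle : ∀ (L M : List A) {N} → Unique (L ++ M ++ N) → Unique (L ++ N)
  Unique-dropMiddle []      M u        = Unique-++⁻ʳ M u
  Unique-dropMiddle (_ ∷ L) M (x∉ ∷ u) =
    All.++⁺ (All.++⁻ˡ L x∉) (All.++⁻ʳ M (All.++⁻ʳ L x∉)) ∷ Unique-dropMiddle L M u

  length-dropMiddle : ∀ (L : List A) {x} M N → length (L ++ N) <ℕ length (L ++ x ∷ M ++ N)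
  length-dropMiddle []      M N rewrite length-++ M {N} = s≤s (ℕ.m≤n+m (length N) (length M))
  length-dropMiddle (_ ∷ L) M N = s≤s (length-dropMiddle L M N)

module _ {A : Set} {ℓ} {_≈_ : Rel A ℓ} (≈-equiv : IsEquivalence _≈_) where
  open IsEquivalence ≈-equiv renaming (refl to ≈-refl; sym to ≈-sym; trans to ≈-trans)

  Grouped-lookup : ∀ {L} → Grouped _≈_ L → ∀ (a b c : Fin (length L)) →
                   toℕ a ≤ℕ toℕ b → toℕ b ≤ℕ toℕ c →
                   lookup L a ≈ lookup L c → lookup L b ≈ lookup L a
  Grouped-lookup {_ ∷ _} _      Fin.zero    Fin.zero    _           _ _       _ = ≈-refl
  Grouped-lookup (x≉ ∷≉ _)      Fin.zero    (Fin.suc _) (Fin.suc c) _ _       x≈c =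
    ⊥-elim (All.lookup x≉ (∈-lookup c) x≈c)
  Grouped-lookup (x≈y ∷≈ g)     Fin.zero    (Fin.suc b) (Fin.suc c) _ (s≤s b≤c) x≈c =
    ≈-trans (Grouped-lookup g Fin.zero b c z≤n b≤c (≈-trans (≈-sym x≈y) x≈c)) (≈-sym x≈y)
  Grouped-lookup (_ ∷≉ g)       (Fin.suc a) (Fin.suc b) (Fin.suc c) (s≤s a≤b) (s≤s b≤c) a≈c =
    Grouped-lookup g a b c a≤b b≤c a≈c
  Grouped-lookup (_ ∷≈ g)       (Fin.suc a) (Fin.suc b) (Fin.suc c) (s≤s a≤b) (s≤s b≤c) a≈c =
    Grouped-lookup g a b c a≤b b≤c a≈c

module _ {V : Set} {R : V → V → Set} {w : V → ℤ} where

  walk-head : ∀ {u v x P} → Walk R w u v (x ∷ P) → u ≡ x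
  walk-head single     = refl
  walk-head (step _ _) = refl

  walk-last : ∀ {u v P} → Walk R w u v P → Last P v
  walk-last single     = last-[]
  walk-last (step _ p) = last-∷ (walk-last p)

  walk-++⁻ : ∀ {u v x y L B} → Last L x → Walk R w u v (L ++ y ∷ B) →
             Walk R w u x L × R x y × Walk R w y v (y ∷ B)
  walk-++⁻                 last-[]    (step r p@single)     = single , r , p
  walk-++⁻                 last-[]    (step r p@(step _ _)) = single , r , p
  walk-++⁻ {L = _ ∷ _ ∷ _} (last-∷ l) (step r p)            = Product.map₁ (step r) (walk-++⁻ l p)

  walk-++⁺ : ∀ {u v x y L B} → Last L x → Walk R w u x L → R x y →
             Walk R w y v (y ∷ B) → Walk R w u v (L ++ y ∷ B)
  walk-++⁺ last-[]    single     r q = step r q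
  walk-++⁺ (last-∷ l) (step r p) s q = step r (walk-++⁺ l p s q)

  wt-++ : ∀ L M → wt R w (L ++ M) ≡ wt R w L + wt R w M
  wt-++ []      M = sym (ℤ.+-identityˡ _)
  wt-++ (x ∷ L) M = trans (cong (w x +_) (wt-++ L M)) (sym (ℤ.+-assoc (w x) _ _))

  wt-dropMiddle : ∀ L M N → 0ℤ ≤ wt R w M → wt R w (L ++ N) ≤ wt R w (L ++ M ++ N)
  wt-dropMiddle []      M N 0≤M = begin
    wt R w N            ≡⟨ ℤ.+-identityˡ _ ⟨
    0ℤ + wt R w N       ≤⟨ ℤ.+-monoˡ-≤ (wt R w N) 0≤M ⟩
    wt R w M + wt R w N ≡⟨ wt-++ M N ⟨
    wt R w (M ++ N)     ∎
    where open ℤ.≤-Reasoning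
  wt-dropMiddle (x ∷ L) M N 0≤M = ℤ.+-monoʳ-≤ (w x) (wt-dropMiddle L M N 0≤M)

  IsShortestPath-dropCycle :
    NoNegativeCycle R w → ∀ {u v x m m' y L M B} →
    Last L x → Last (m ∷ M) m' → R x y → R m' m →
    IsShortestPath R w u v (L ++ (m ∷ M) ++ y ∷ B) → IsShortestPath R w u v (L ++ y ∷ B)
  IsShortestPath-dropCycle noNeg {m = m} {m'} {L = L} {M} L-last M-last x→y m'→m
                           ((walk , unique) , minimal) =
    let toX , _ , fromM       = walk-++⁻ L-last walk
        aroundM , _ , fromY   = walk-++⁻ M-last fromM
        cycle : IsCycle R w (m ∷ M)
        cycle = m , m' , (aroundM , Unique-++⁻ˡ (m ∷ M) (Unique-++⁻ʳ L unique)) , m'→m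
    in (walk-++⁺ L-last toX x→y fromY , Unique-dropMiddle L (m ∷ M) unique) ,
       λ Q q → ℤ.≤-trans (wt-dropMiddle L (m ∷ M) _ (ℤ.≮⇒≥ (noNeg _ cycle))) (minimal Q q)

module Colouring {A C : Set} (_≟ᶜ_ : DecidableEquality C) (colour : A → C) where

  _≈_ : A → A → Set
  _≈_ = _≡_ on colour

  -- The path steps x → m into the segment m … m' and leaves it by m' → y.
  Bypassable : A → A → A → A → Set
  Bypassable x m m' y = ¬ x ≈ m × ¬ m' ≈ y × (x ≈ m' ⊎ m ≈ y)

  record Shortcut (P : List A) : Set where
    field
      prefix        : List A
      {x m m' y}    : A
      middle suffix : List A
      split         : P ≡ prefix ++ (m ∷ middle) ++ y ∷ suffix
      prefix-last   : Last prefix x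
      segment-last  : Last (m ∷ middle) m'
      bypassable    : Bypassable x m m' y

  Shortcut-∷ : ∀ z {P} → Shortcut P → Shortcut (z ∷ P)
  Shortcut-∷ z s = record
    { prefix = z ∷ prefix ; middle = middle ; suffix = suffix
    ; split = cong (z ∷_) split ; prefix-last = last-∷ prefix-last
    ; segment-last = segment-last ; bypassable = bypassable }
    where open Shortcut s

  record Cut (z : A) (L : List A) : Set where
    field
      middle   : List A
      end next : A
      rest     : List A
      split    : L ≡ middle ++ next ∷ rest
      end-last : Last (z ∷ middle) end
  open Cut

  Cut-∷ : ∀ x {z L} → Cut z L → Cut x (z ∷ L)
  Cut-∷ x c = record
    { middle = _ ∷ middle c ; end = end c ; next = next c ; rest = rest c
    ; split = cong (_ ∷_) (split c) ; end-last = last-∷ (end-last c) }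

  Exit : C → ∀ {z L} → Cut z L → Set
  Exit i c = i ≡ colour (end c) × i ≢ colour (next c)

  Final : C → ∀ {z L} → Cut z L → Set
  Final i c = i ≢ colour (end c) × All ((i ≡_) ∘ colour) (next c ∷ rest c)

  -- After leaving the block of x, the list x ∷ L returns to it for good.
  Returns : A → List A → Set
  Returns x L = Σ (Cut x L) (Final (colour x))

  Cut-here : ∀ z a L → Cut z (a ∷ L)
  Cut-here z a L = record
    { middle = [] ; end = z ; next = a ; rest = L ; split = refl ; end-last = last-[] }

  shortcutAfter : ∀ x {z L} (c : Cut z L) → Bypassable x z (end c) (next c) →
                  Shortcut (x ∷ z ∷ L)
  shortcutAfter x {z} c bypassable = record
    { prefix = x ∷ [] ; middle = middle c ; suffix = rest c
    ; split = cong (λ L → x ∷ z ∷ L) (split c)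
    ; prefix-last = last-[] ; segment-last = end-last c ; bypassable = bypassable }

  runEnd : ∀ i z L → i ≡ colour z → Σ (Cut z L) (Exit i) ⊎ All ((i ≡_) ∘ colour) (z ∷ L)
  runEnd i z []      i≡z = inj₂ (i≡z ∷ [])
  runEnd i z (a ∷ L) i≡z with i ≟ᶜ colour a
  ... | no i≢a  = inj₁ (Cut-here z a L , i≡z , i≢a)
  ... | yes i≡a = Sum.map (Product.map (Cut-∷ z) id) (i≡z ∷_) (runEnd i a L i≡a)

  firstRunEnd : ∀ i z L → i ≢ colour z → Any ((i ≡_) ∘ colour) L →
                Σ (Cut z L) (λ c → Exit i c ⊎ Final i c)
  firstRunEnd i z (a ∷ L) i≢z found with i ≟ᶜ colour a
  ... | no i≢a = Product.map (Cut-∷ z) id (firstRunEnd i a L i≢a (Any.tail i≢a found))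
  ... | yes i≡a with runEnd i a L i≡a
  ...   | inj₁ (c , exit) = Cut-∷ z c , inj₁ exit
  ...   | inj₂ final      = Cut-here z a L , inj₂ (i≢z , final)

  Grouped-∷ : ∀ x {z L} → Grouped _≈_ (z ∷ L) →
              Grouped _≈_ (x ∷ z ∷ L) ⊎ Shortcut (x ∷ z ∷ L) ⊎ Returns x (z ∷ L)
  Grouped-∷ x {z} {L} g with colour x ≟ᶜ colour z
  ... | yes x≈z = inj₁ (x≈z ∷≈ g)
  ... | no x≉z with any? (λ a → colour x ≟ᶜ colour a) L
  ...   | no absent = inj₁ ((x≉z ∷ All.¬Any⇒All¬ L absent) ∷≉ g)
  ...   | yes present with firstRunEnd (colour x) z L x≉z present
  ...     | c , inj₁ (x≈end , x≉next) =
              inj₂ (inj₁ (shortcutAfter x c (x≉z , (x≉next ∘ trans x≈end) , inj₁ x≈end)))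
  ...     | c , inj₂ final = inj₂ (inj₂ (Cut-∷ x c , final))

  Returns-∷ : ∀ x {z L} → Returns z L → Shortcut (x ∷ z ∷ L) ⊎ Returns x (z ∷ L)
  Returns-∷ x {z} (c , z≉end , final) with colour x ≟ᶜ colour z
  ... | yes x≈z = inj₂ (Cut-∷ x c , (z≉end ∘ trans (sym x≈z)) , All.map (trans x≈z) final)
  ... | no x≉z = inj₁ (shortcutAfter x c
                   (x≉z , (z≉end ∘ trans (All.head final) ∘ sym) , inj₂ (All.head final)))

  classify : ∀ x L → Grouped _≈_ (x ∷ L) ⊎ Shortcut (x ∷ L) ⊎ Returns x L
  classify x []      = inj₁ ([] ∷≉ [])
  classify x (z ∷ L) with classify z L
  ... | inj₁ g        = Grouped-∷ x g
  ... | inj₂ (inj₁ s) = inj₂ (inj₁ (Shortcut-∷ x s))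
  ... | inj₂ (inj₂ r) = inj₂ (Returns-∷ x r)

  Returns⇒≈last : ∀ {x L z} → Returns x L → Last (x ∷ L) z → x ≈ z
  Returns⇒≈last {x} (c , _ , final) l rewrite split c =
    All-last final (Last-++⁻ʳ (x ∷ middle c) l)

  Grouped⊎Shortcut : ∀ {x L z} → Last (x ∷ L) z → ¬ x ≈ z →
                     Grouped _≈_ (x ∷ L) ⊎ Shortcut (x ∷ L)
  Grouped⊎Shortcut {x} {L} l x≉z with classify x L
  ... | inj₁ g        = inj₁ g
  ... | inj₂ (inj₁ s) = inj₂ s
  ... | inj₂ (inj₂ r) = ⊥-elim (x≉z (Returns⇒≈last r l))

module _ {t : ℕ} {H : Digraph t} {sz : Fin t → ℕ} {G : (i : Fin t) → WDigraph (sz i)} where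
  open Colouring _≟_ (proj₁ {B = λ i → Fin (sz i)})

  private
    R = SubstArc H G
    W = SubstWeight G

  SubstArc-rewire : ∀ {a b c d} → R a b → proj₁ a ≢ proj₁ b →
                    proj₁ c ≡ proj₁ a → proj₁ d ≡ proj₁ b → R c d
  SubstArc-rewire (inner _) a≢b = ⊥-elim (a≢b refl)
  SubstArc-rewire (outer h) _ refl refl = outer h

  Bypassable⇒arcs : ∀ {x m m' y} → R x m → R m' y → Bypassable x m m' y → R m' m × R x y
  Bypassable⇒arcs x→m m'→y (x≉m , m'≉y , inj₁ x≈m') =
    SubstArc-rewire x→m x≉m (sym x≈m') refl , SubstArc-rewire m'→y m'≉y x≈m' refl
  Bypassable⇒arcs x→m m'→y (x≉m , m'≉y , inj₂ m≈y) =
    SubstArc-rewire m'→y m'≉y refl m≈y , SubstArc-rewire x→m x≉m refl (sym m≈y)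

  Shortcut⇒shorterShortestPath : NoNegativeCycle R W → ∀ {u v P} →
    IsShortestPath R W u v P → Shortcut P →
    ∃ λ Q → IsShortestPath R W u v Q × length Q <ℕ length P
  Shortcut⇒shorterShortestPath noNeg sp
    record { prefix = L ; middle = M ; suffix = B ; split = refl
           ; prefix-last = L-last ; segment-last = M-last ; bypassable = bypassable } =
    let _ , x→m , fromM = walk-++⁻ L-last (proj₁ (proj₁ sp))
        _ , m'→y , _    = walk-++⁻ M-last fromM
        m'→m , x→y      = Bypassable⇒arcs x→m m'→y bypassable
    in L ++ _ ∷ B ,
       IsShortestPath-dropCycle noNeg L-last M-last x→y m'→m sp ,
       length-dropMiddle L M (_ ∷ B)

  groupedShortestPath : NoNegativeCycle R W → ∀ {u v} → proj₁ u ≢ proj₁ v →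
    ∀ P → Acc _<ℕ_ (length P) → IsShortestPath R W u v P →
    ∃ λ Q → IsShortestPath R W u v Q × Grouped _≈_ Q
  groupedShortestPath noNeg u≉v []      _         ((() , _) , _)
  groupedShortestPath noNeg u≉v (x ∷ L) (acc rec) sp@((walk , _) , _) with walk-head walk
  ... | refl with Grouped⊎Shortcut (walk-last walk) u≉v
  ...   | inj₁ grouped  = x ∷ L , sp , grouped
  ...   | inj₂ shortcut =
          let Q , spQ , Q<P = Shortcut⇒shorterShortestPath noNeg sp shortcut
          in groupedShortestPath noNeg u≉v Q (rec Q<P) spQ

lemma17 : (t : ℕ) (H : Digraph t) (sz : Fin t → ℕ) (G : (i : Fin t) → WDigraph (sz i))
          → NoNegativeCycle (SubstArc H G) (SubstWeight G)
          → (u v : Σ (Fin t) (λ i → Fin (sz i)))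
          → ∃ (λ (P : List (Σ (Fin t) (λ i → Fin (sz i)))) → IsShortestPath (SubstArc H G) (SubstWeight G) u v P)
          → proj₁ u ≢ proj₁ v
          → ∃ (λ (P : List (Σ (Fin t) (λ i → Fin (sz i)))) → IsShortestPath (SubstArc H G) (SubstWeight G) u v P × BlocksConsecutive P)
lemma17 t H sz G noNeg u v (P , shortest) u≉v =
  let Q , shortestQ , grouped =
        groupedShortestPath noNeg u≉v P (<-wellFounded (length P)) shortest
  in Q , shortestQ , Grouped-lookup (On.isEquivalence proj₁ ≡.isEquivalence) grouped
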